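{- Let $n\ge1$, let $A,B,A',B'\in\mathcal P$ and let $f_i,g_i\in{\rm Epi}(A,B)$, $f'_i,g'_i\in{\rm Epi}(A',B')$ for $i=1,\dots,n$. Then there exist $A^+,B^+\in\mathcal P$, $f_i^+,g_i^+\in{\rm Epi}(A^+,B^+)$ ($1\le i\le n$), and $\alpha\in{\rm Epi}(A^+,A)$, $\alpha'\in{\rm Epi}(A^+,A')$ such that for each $1\le i\le n$: $\alpha$ is an epimorphism from $(A^+,B^+,f_i^+,g_i^+)$ to $(A,B,f_i,g_i)$, and $\alpha'$ is an approximate epimorphism from $(A^+,B^+,f_i^+,g_i^+)$ to $(A',B',f'_i,g'_i)$.
   Context: $\mathcal P$ is the class of finite reflexive linear graphs: structures isomorphic to $\{0,\dots,n\}$ with $xRy\iff|x-y|\le1$. ${\rm Epi}(A,B)$: maps $f:A\to B$ with $aRb\Rightarrow f(a)Rf(b)$ such that every pair $b_1Rb_2$ in $B$ is $(f(a_1),f(a_2))$ for some $a_1Ra_2$. For $f,g\in{\rm Epi}(C,D)$ and $f',g'\in{\rm Epi}(C',D')$, a map $\alpha\in{\rm Epi}(C,C')$ is an epimorphism (resp. approximate epimorphism) from $(C,D,f,g)$ to $(C',D',f',g')$ if for all $a_0,a_1\in C$ with $f(a_0)=g(a_1)$ we have $f'(\alpha(a_0))=g'(\alpha(a_1))$ (resp. $f'(\alpha(a_0))\,R\,g'(\alpha(a_1))$). -}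

module Defs where

open import Data.Nat using (ℕ; suc; _≤_)
open import Data.Fin using (Fin; toℕ)
open import Data.Product using (Σ; ∃; _×_; _,_)
open import Relation.Binary.PropositionalEquality using (_≡_)

-- The linear graph with n+1 vertices {0,…,n}; every member of 𝒫 is
-- isomorphic to exactly one such graph, so 𝒫 is represented by ℕ.
L : ℕ → Set
L n = Fin (suc n)

R : {n : ℕ} → L n → L n → Set
R x y = (toℕ x ≤ suc (toℕ y)) × (toℕ y ≤ suc (toℕ x))

record Epi (a b : ℕ) : Set where
  field
    fun  : L a → L b
    hom  : ∀ {x y} → R x y → R (fun x) (fun y)
    onto : ∀ (u v : L b) → R u v →
           Σ (L a) λ x → Σ (L a) λ y → R x y × (fun x ≡ u) × (fun y ≡ v)
open Epi public

IsEpiFrom : {c d c' d' : ℕ} → Epi c c' →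
            Epi c d → Epi c d → Epi c' d' → Epi c' d' → Set
IsEpiFrom α f g f' g' =
  ∀ a₀ a₁ → fun f a₀ ≡ fun g a₁ →
    fun f' (fun α a₀) ≡ fun g' (fun α a₁)

IsApproxEpiFrom : {c d c' d' : ℕ} → Epi c c' →
                  Epi c d → Epi c d → Epi c' d' → Epi c' d' → Set
IsApproxEpiFrom α f g f' g' =
  ∀ a₀ a₁ → fun f a₀ ≡ fun g a₁ →
    R (fun f' (fun α a₀)) (fun g' (fun α a₁))

-- Cut A⁺ into stages k = 0, …, 2a'. In every stage α runs through A forwards and back,
-- resting one step at each vertex, while α' stays at ⌊k/2⌋. Take B⁺ to be a snake of
-- 2b'+1 copies of B, odd rows laid out backwards, so that consecutive rows meet in a corner.
-- The lift of a pair (φ, φ') sends t to the copy of φ(α t) in a row that, during stage k,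
-- passes from φ'⌊(k-1)/2⌋ + φ'⌊k/2⌋ to φ'⌊k/2⌋ + φ'⌈k/2⌉ while α rests at a preimage of the
-- corner joining the two rows; both rows are within 1 of 2·φ'(α' t). If the lifts of (φ, φ')
-- and (ψ, ψ') agree at t₀ and t₁, they agree in row and in column: the columns give
-- φ(α t₀) = ψ(α t₁), the rows give |2φ'(α' t₀) − 2ψ'(α' t₁)| ≤ 2. Every map built this way is
-- a walk reaching both ends of its target, and by a discrete intermediate value argument such
-- a walk covers every edge, i.e. it is an epimorphism.

module Submission where

open import Defs
open import Data.Empty using (⊥-elim)
open import Data.Fin using (Fin; toℕ; fromℕ<)
open import Data.Fin.Properties using (toℕ<n; toℕ-fromℕ<; toℕ-injective)
open import Data.Nat
  using ( ℕ; zero; suc; _+_; _*_; _∸_; _⊓_; _≤_; _<_; z≤n; s≤s; s≤s⁻¹; _≤?_; _<?_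
        ; ⌊_/2⌋; ⌈_/2⌉; NonZero )
open import Data.Nat.DivMod
  using ( _/_; _%_; m≡m%n+[m/n]*n; m%n<n; [m+kn]%n≡m%n; m<n⇒m%n≡m; +-distrib-/-∣ʳ
        ; m<n⇒m/n≡0; m*n/n≡m; /-monoˡ-≤ )
open import Data.Nat.Divisibility using (divides-refl)
open import Data.Nat.Properties
open import Data.Product using (Σ; ∃-syntax; _×_; _,_; proj₁; proj₂)
open import Data.Sum using (_⊎_; inj₁; inj₂; [_,_]′)
open import Relation.Binary.Core using (_Preserves_⟶_; _Preserves₂_⟶_⟶_)
open import Relation.Binary.Definitions using (tri<; tri≈; tri>)
open import Function using (_∘_)
open import Relation.Binary.PropositionalEquality
open import Relation.Nullary using (¬_; yes; no; contradiction)
open import Relation.Unary using (Decidable)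
open ≡-Reasoning

-- R x y unfolds to Adj (toℕ x) (toℕ y).
Adj : ℕ → ℕ → Set
Adj x y = x ≤ suc y × y ≤ suc x

adj-refl : ∀ x → Adj x x
adj-refl x = n≤1+n x , n≤1+n x

adj-reflexive : ∀ {x y} → x ≡ y → Adj x y
adj-reflexive {x} refl = adj-refl x

adj-sym : ∀ {x y} → Adj x y → Adj y x
adj-sym (x≤1+y , y≤1+x) = y≤1+x , x≤1+y

adj-suc : ∀ x → Adj x (suc x)
adj-suc x = m≤n⇒m≤1+n (n≤1+n x) , ≤-refl

adj-cases : ∀ {x y} → Adj x y → x ≡ y ⊎ suc x ≡ y ⊎ x ≡ suc y
adj-cases {x} {y} (x≤1+y , y≤1+x) with <-cmp x y
... | tri< x<y _ _ = inj₂ (inj₁ (≤-antisym x<y y≤1+x))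
... | tri≈ _ x≡y _ = inj₁ x≡y
... | tri> _ _ y<x = inj₂ (inj₂ (≤-antisym x≤1+y y<x))

adj-straddle : ∀ {x y u} → Adj x y → x ≤ u → u < y → x ≡ u × y ≡ suc u
adj-straddle (x≤1+y , y≤1+x) x≤u u<y =
  ≤-antisym x≤u (s≤s⁻¹ (≤-trans u<y y≤1+x)) , ≤-antisym (≤-trans y≤1+x (s≤s x≤u)) u<y

StepAdj : (ℕ → ℕ) → Set
StepAdj w = ∀ t → Adj (w t) (w (suc t))

stepAdj⇒adj : ∀ {w} → StepAdj w → w Preserves Adj ⟶ Adj
stepAdj⇒adj step xy with adj-cases xy
... | inj₁ refl = adj-refl _
... | inj₂ (inj₁ refl) = step _
... | inj₂ (inj₂ refl) = adj-sym (step _)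

adj-+ˡ : ∀ c → (c +_) Preserves Adj ⟶ Adj
adj-+ˡ c = stepAdj⇒adj λ t → subst (Adj (c + t)) (sym (+-suc c t)) (adj-suc (c + t))

adj-+ʳ : ∀ c → (_+ c) Preserves Adj ⟶ Adj
adj-+ʳ c = stepAdj⇒adj λ t → adj-suc (t + c)

∸-step : ∀ c n → Adj (c ∸ n) (c ∸ suc n)
∸-step zero zero = adj-refl 0
∸-step zero (suc n) = adj-refl 0
∸-step (suc c) zero = adj-sym (adj-suc c)
∸-step (suc c) (suc n) = ∸-step c n

adj-∸ˡ : ∀ c → (c ∸_) Preserves Adj ⟶ Adj
adj-∸ˡ c = stepAdj⇒adj (∸-step c)

⌊/2⌋-step : ∀ n → Adj ⌊ n /2⌋ ⌈ n /2⌉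
⌊/2⌋-step zero = adj-refl 0
⌊/2⌋-step (suc zero) = adj-suc 0
⌊/2⌋-step (suc (suc n)) with ⌊/2⌋-step n
... | p , q = s≤s p , s≤s q

adj-⌊/2⌋ : ⌊_/2⌋ Preserves Adj ⟶ Adj
adj-⌊/2⌋ = stepAdj⇒adj ⌊/2⌋-step

adj-⊓ : _⊓_ Preserves₂ Adj ⟶ Adj ⟶ Adj
adj-⊓ (x≤1+x' , x'≤1+x) (y≤1+y' , y'≤1+y) = ⊓-mono-≤ x≤1+x' y≤1+y' , ⊓-mono-≤ x'≤1+x y'≤1+y

double-adj⁻¹ : ∀ {r u w} → Adj r (u + u) → Adj r (w + w) → Adj u w
double-adj⁻¹ (r≤1+2u , 2u≤1+r) (r≤1+2w , 2w≤1+r) =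
  halve (≤-trans 2u≤1+r (s≤s r≤1+2w)) , halve (≤-trans 2w≤1+r (s≤s r≤1+2u))
  where
    halve : ∀ {u w} → u + u ≤ suc (suc (w + w)) → u ≤ suc w
    halve {u} {w} le =
      subst₂ _≤_ (sym (n≡⌊n+n/2⌋ u)) (cong suc (sym (n≡⌊n+n/2⌋ w))) (⌊n/2⌋-mono le)

[m+kn]/n≡k : ∀ {m n} .{{_ : NonZero n}} k → m < n → (m + k * n) / n ≡ k
[m+kn]/n≡k {m} {n} k m<n = begin
  (m + k * n) / n     ≡⟨ +-distrib-/-∣ʳ m (divides-refl k) ⟩
  m / n + k * n / n   ≡⟨ cong₂ _+_ (m<n⇒m/n≡0 m<n) (m*n/n≡m k n) ⟩
  k                   ∎

[m+kn]%n≡m : ∀ {m n} .{{_ : NonZero n}} k → m < n → (m + k * n) % n ≡ m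
[m+kn]%n≡m {m} {n} k m<n = trans ([m+kn]%n≡m%n m k n) (m<n⇒m%n≡m m<n)

exit-step : ∀ {P : ℕ → Set} → Decidable P → ∀ {i k} → i ≤ k → P i → ¬ P k →
             ∃[ s ] s < k × P s × ¬ P (suc s)
exit-step P? {k = zero} z≤n Pi ¬Pk = ⊥-elim (¬Pk Pi)
exit-step P? {i} {suc k} i≤1+k Pi ¬P1+k with P? k | m≤n⇒m<n∨m≡n i≤1+k
... | yes Pk  | _          = k , ≤-refl , Pk , ¬P1+k
... | no _    | inj₂ refl  = ⊥-elim (¬P1+k Pi)
... | no ¬Pk  | inj₁ i<1+k with exit-step P? (s≤s⁻¹ i<1+k) Pi ¬Pk
...   | s , s<k , Ps , ¬P1+s = s , m<n⇒m<1+n s<k , Ps , ¬P1+s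

Reaches : ℕ → (ℕ → ℕ) → ℕ → Set
Reaches N w z = ∃[ t ] t ≤ N × w t ≡ z

Traverses : (ℕ → ℕ) → ℕ → ℕ → Set
Traverses w u s = (w s ≡ u × w (suc s) ≡ suc u) ⊎ (w s ≡ suc u × w (suc s) ≡ u)

crossing : ∀ {w N u t₁ t₂} → StepAdj w → t₁ ≤ N → t₂ ≤ N → w t₁ ≤ u → u < w t₂ →
           ∃[ s ] s < N × Traverses w u s
crossing {w} {N} {u} {t₁} {t₂} step t₁≤N t₂≤N below above with ≤-total t₁ t₂
... | inj₁ t₁≤t₂ with exit-step (λ t → w t ≤? u) t₁≤t₂ below (<⇒≱ above)
...   | s , s<t₂ , ws≤u , ws'≰u =
  s , <-≤-trans s<t₂ t₂≤N , inj₁ (adj-straddle (step s) ws≤u (≰⇒> ws'≰u))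
crossing {w} {N} {u} step t₁≤N t₂≤N below above | inj₂ t₂≤t₁
  with exit-step (λ t → u <? w t) t₂≤t₁ above (≤⇒≯ below)
...   | s , s<t₁ , u<ws , ws'≯u with adj-straddle (adj-sym (step s)) (≮⇒≥ ws'≯u) u<ws
...     | ws'≡u , ws≡1+u = s , <-≤-trans s<t₁ t₁≤N , inj₂ (ws≡1+u , ws'≡u)

record Walk (N M : ℕ) : Set where
  field
    pos       : ℕ → ℕ
    step      : StepAdj pos
    bounded   : ∀ {t} → t ≤ N → pos t ≤ M
    reaches-0 : Reaches N pos 0
    reaches-M : Reaches N pos M

  traverses : ∀ {u} → u < M → ∃[ s ] s < N × Traverses pos u s
  traverses u<M with reaches-0 | reaches-M
  ... | t₀ , t₀≤N , pos-t₀≡0 | t₁ , t₁≤N , pos-t₁≡M =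
    crossing step t₀≤N t₁≤N (subst (_≤ _) (sym pos-t₀≡0) z≤n) (subst (_ <_) (sym pos-t₁≡M) u<M)

  reaches : ∀ {u} → u ≤ M → Reaches N pos u
  reaches {zero} _ = reaches-0
  reaches {suc u} u<M with traverses u<M
  ... | s , s<N , inj₁ (_ , e) = suc s , s<N , e
  ... | s , s<N , inj₂ (e , _) = s , <⇒≤ s<N , e

toFin : ∀ {n y} → y ≤ n → L n
toFin y≤n = fromℕ< (s≤s y≤n)

toℕ-toFin : ∀ {n y} (y≤n : y ≤ n) → toℕ (toFin y≤n) ≡ y
toℕ-toFin y≤n = toℕ-fromℕ< (s≤s y≤n)

toℕ≤ : ∀ {n} (x : L n) → toℕ x ≤ n
toℕ≤ x = s≤s⁻¹ (toℕ<n x)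

R-toFin : ∀ {n s t} (s≤n : s ≤ n) (t≤n : t ≤ n) → Adj s t → R (toFin s≤n) (toFin t≤n)
R-toFin s≤n t≤n = subst₂ Adj (sym (toℕ-toFin s≤n)) (sym (toℕ-toFin t≤n))

module _ {N M : ℕ} (W : Walk N M) where
  open Walk W

  walkFun : L N → L M
  walkFun x = toFin (bounded (toℕ≤ x))

  toℕ-walkFun : ∀ x → toℕ (walkFun x) ≡ pos (toℕ x)
  toℕ-walkFun x = toℕ-toFin (bounded (toℕ≤ x))

  private
    EdgeCover : L M → L M → Set
    EdgeCover u v = Σ (L N) λ x → Σ (L N) λ y → R x y × (walkFun x ≡ u) × (walkFun y ≡ v)

    visit : ∀ {t} (t≤N : t ≤ N) {u} → pos t ≡ toℕ u → walkFun (toFin t≤N) ≡ u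
    visit t≤N pos-t≡u = toℕ-injective (trans (toℕ-walkFun _) (trans (cong pos (toℕ-toFin t≤N)) pos-t≡u))

    cover-swap : ∀ {u v} → EdgeCover u v → EdgeCover v u
    cover-swap (x , y , xRy , fx≡u , fy≡v) = y , x , adj-sym xRy , fy≡v , fx≡u

    cover-edge : ∀ u v → suc (toℕ u) ≡ toℕ v → EdgeCover u v
    cover-edge u v 1+u≡v with traverses (subst (_≤ M) (sym 1+u≡v) (toℕ≤ v))
    ... | s , s<N , inj₁ (pos-s≡u , pos-1+s≡1+u) =
      toFin (<⇒≤ s<N) , toFin s<N , R-toFin (<⇒≤ s<N) s<N (adj-suc s) ,
      visit (<⇒≤ s<N) pos-s≡u , visit s<N (trans pos-1+s≡1+u 1+u≡v)
    ... | s , s<N , inj₂ (pos-s≡1+u , pos-1+s≡u) =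
      toFin s<N , toFin (<⇒≤ s<N) , R-toFin s<N (<⇒≤ s<N) (adj-sym (adj-suc s)) ,
      visit s<N pos-1+s≡u , visit (<⇒≤ s<N) (trans pos-s≡1+u 1+u≡v)

    cover : ∀ u v → R u v → EdgeCover u v
    cover u v uRv with adj-cases uRv
    ... | inj₁ u≡v with reaches (toℕ≤ u)
    ...   | t , t≤N , pos-t≡u =
      toFin t≤N , toFin t≤N , adj-refl _ , visit t≤N pos-t≡u , visit t≤N (trans pos-t≡u u≡v)
    cover u v uRv | inj₂ (inj₁ 1+u≡v) = cover-edge u v 1+u≡v
    cover u v uRv | inj₂ (inj₂ u≡1+v) = cover-swap (cover-edge v u (sym u≡1+v))

  walkEpi : Epi N M
  walkEpi = record
    { fun  = walkFun
    ; hom  = λ {x} {y} xRy →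
               subst₂ Adj (sym (toℕ-walkFun x)) (sym (toℕ-walkFun y)) (stepAdj⇒adj step xRy)
    ; onto = cover
    }

module _ {a b : ℕ} (φ : Epi a b) where
  -- Arguments beyond a are clamped to a.
  epiℕ : ℕ → ℕ
  epiℕ y = toℕ (fun φ (toFin (m⊓n≤n y a)))

  epiℕ-toℕ : ∀ x → epiℕ (toℕ x) ≡ toℕ (fun φ x)
  epiℕ-toℕ x = cong (λ z → toℕ (fun φ z))
    (toℕ-injective (trans (toℕ-toFin (m⊓n≤n (toℕ x) a)) (m≤n⇒m⊓n≡m (toℕ≤ x))))

  epiℕ-≤ : ∀ y → epiℕ y ≤ b
  epiℕ-≤ y = toℕ≤ _

  epiℕ-adj : epiℕ Preserves Adj ⟶ Adj
  epiℕ-adj {y} {z} yz = hom φ (R-toFin (m⊓n≤n y a) (m⊓n≤n z a) (adj-⊓ yz (adj-refl a)))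

  epiℕ-onto : ∀ {x} → x ≤ b → ∃[ y ] y ≤ a × epiℕ y ≡ x
  epiℕ-onto x≤b with onto φ (toFin x≤b) (toFin x≤b) (adj-refl _)
  ... | y , _ , _ , φy≡x , _ =
    toℕ y , toℕ≤ y , trans (epiℕ-toℕ y) (trans (cong toℕ φy≡x) (toℕ-toFin x≤b))

toℕ-fun-walkFun : ∀ {N M c} (φ : Epi M c) (W : Walk N M) x →
                  toℕ (fun φ (walkFun W x)) ≡ epiℕ φ (Walk.pos W (toℕ x))
toℕ-fun-walkFun φ W x = trans (sym (epiℕ-toℕ φ (walkFun W x))) (cong (epiℕ φ) (toℕ-walkFun W x))

walkFun-agree : ∀ {N M} (W W' : Walk N M) {x y} → walkFun W x ≡ walkFun W' y →
                Walk.pos W (toℕ x) ≡ Walk.pos W' (toℕ y)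
walkFun-agree W W' {x} {y} same = trans (sym (toℕ-walkFun W x)) (trans (cong toℕ same) (toℕ-walkFun W' y))

module Glue (ℓ : ℕ) where
  glue : (ℕ → ℕ → ℕ) → ℕ → ℕ
  glue G t = G (t / suc ℓ) (t % suc ℓ)

  glue-at : ∀ G k {q} → q ≤ ℓ → glue G (q + k * suc ℓ) ≡ G k q
  glue-at G k q≤ℓ = cong₂ G ([m+kn]/n≡k k (s≤s q≤ℓ)) ([m+kn]%n≡m k (s≤s q≤ℓ))

  glue-block-≤ : ∀ {t} k → t ≤ ℓ + k * suc ℓ → t / suc ℓ ≤ k
  glue-block-≤ k t≤ = ≤-trans (/-monoˡ-≤ (suc ℓ) t≤) (≤-reflexive ([m+kn]/n≡k {ℓ} k ≤-refl))

  glue-step : ∀ G → (∀ k q → q < ℓ → Adj (G k q) (G k (suc q))) →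
              (∀ k → Adj (G k ℓ) (G (suc k) 0)) → StepAdj (glue G)
  glue-step G inner boundary t = step (m≤n⇒m<n∨m≡n (s≤s⁻¹ (m%n<n t (suc ℓ))))
    where
      k q : ℕ
      k = t / suc ℓ
      q = t % suc ℓ
      1+t≡ : suc t ≡ suc q + k * suc ℓ
      1+t≡ = cong suc (m≡m%n+[m/n]*n t (suc ℓ))
      step : q < ℓ ⊎ q ≡ ℓ → Adj (glue G t) (glue G (suc t))
      step (inj₁ q<ℓ) =
        subst (Adj (G k q)) (sym (trans (cong (glue G) 1+t≡) (glue-at G k q<ℓ))) (inner k q q<ℓ)
      step (inj₂ q≡ℓ) =
        subst₂ Adj (cong (G k) (sym q≡ℓ)) (sym (trans (cong (glue G) 1+t≡′) (glue-at G (suc k) z≤n)))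
          (boundary k)
        where
          1+t≡′ : suc t ≡ suc k * suc ℓ
          1+t≡′ = trans 1+t≡ (cong (λ p → suc p + k * suc ℓ) q≡ℓ)

module Tent (a : ℕ) where
  M : ℕ
  M = suc (a + a)

  ℓ : ℕ
  ℓ = suc (M + M)

  -- On positions 0, …, ℓ the tent takes the values 0,0,1,1,…,a,a,a,a,…,1,1,0,0.
  zig : ℕ → ℕ
  zig q = q ⊓ (ℓ ∸ q)

  tent : ℕ → ℕ
  tent q = ⌊ zig q /2⌋

  double<M : ∀ {y} → y ≤ a → y + y < M
  double<M y≤a = s≤s (+-mono-≤ y≤a y≤a)

  M<ℓ : M < ℓ
  M<ℓ = s≤s (m≤m+n M M)

  M<ℓ∸ : ∀ {q} → q ≤ M → M < ℓ ∸ q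
  M<ℓ∸ q≤M = ≤-trans (≤-reflexive (sym (m+n∸n≡m (suc M) M))) (∸-monoʳ-≤ ℓ q≤M)

  zig-forward : ∀ {q} → q ≤ M → zig q ≡ q
  zig-forward q≤M = m≤n⇒m⊓n≡m (≤-trans q≤M (<⇒≤ (M<ℓ∸ q≤M)))

  zig-mirror : ∀ {q} → q ≤ ℓ → zig (ℓ ∸ q) ≡ zig q
  zig-mirror {q} q≤ℓ = trans (cong ((ℓ ∸ q) ⊓_) (m∸[m∸n]≡n q≤ℓ)) (⊓-comm (ℓ ∸ q) q)

  zig-≤ : ∀ q → zig q ≤ M
  zig-≤ q with q ≤? M
  ... | yes q≤M = ≤-trans (m⊓n≤m q (ℓ ∸ q)) q≤M
  ... | no q≰M =
    ≤-trans (m⊓n≤n q (ℓ ∸ q)) (≤-trans (∸-monoʳ-≤ ℓ (≰⇒> q≰M)) (≤-reflexive (m+n∸n≡m M M)))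

  tent-≤ : ∀ q → tent q ≤ a
  tent-≤ q = ≤-trans (⌊n/2⌋-mono (zig-≤ q)) (≤-reflexive (sym (n≡⌈n+n/2⌉ a)))

  tent-adj : tent Preserves Adj ⟶ Adj
  tent-adj qr = adj-⌊/2⌋ (adj-⊓ qr (adj-∸ˡ ℓ qr))

  tent-double : ∀ {y} → y ≤ a → tent (y + y) ≡ y
  tent-double {y} y≤a = trans (cong ⌊_/2⌋ (zig-forward (<⇒≤ (double<M y≤a)))) (sym (n≡⌊n+n/2⌋ y))

  tent-double+1 : ∀ {y} → y ≤ a → tent (suc (y + y)) ≡ y
  tent-double+1 {y} y≤a = trans (cong ⌊_/2⌋ (zig-forward (double<M y≤a))) (sym (n≡⌈n+n/2⌉ y))

  tent-mirror-double : ∀ {y} → y ≤ a → tent (ℓ ∸ (y + y)) ≡ y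
  tent-mirror-double y≤a =
    trans (cong ⌊_/2⌋ (zig-mirror (<⇒≤ (<-trans (double<M y≤a) M<ℓ)))) (tent-double y≤a)

  tent-ℓ : tent ℓ ≡ 0
  tent-ℓ = cong ⌊_/2⌋ (trans (cong (ℓ ⊓_) (n∸n≡0 ℓ)) (⊓-zeroʳ ℓ))

module Snake (b : ℕ) where
  orient : ℕ → ℕ → ℕ
  orient zero x = x
  orient (suc zero) x = b ∸ x
  orient (suc (suc r)) x = orient r x

  -- Row r occupies r (b+1), …, r (b+1) + b; adjacent rows r, r' are joined at column corner r r'.
  snake : ℕ → ℕ → ℕ
  snake r x = orient r x + r * suc b

  corner : ℕ → ℕ → ℕ
  corner r r' = orient (r ⊓ r') b

  orient-≤ : ∀ r {x} → x ≤ b → orient r x ≤ b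
  orient-≤ zero x≤b = x≤b
  orient-≤ (suc zero) {x} _ = m∸n≤m b x
  orient-≤ (suc (suc r)) x≤b = orient-≤ r x≤b

  orient-involutive : ∀ r {x} → x ≤ b → orient r (orient r x) ≡ x
  orient-involutive zero _ = refl
  orient-involutive (suc zero) x≤b = m∸[m∸n]≡n x≤b
  orient-involutive (suc (suc r)) x≤b = orient-involutive r x≤b

  orient-adj : ∀ r → orient r Preserves Adj ⟶ Adj
  orient-adj zero xy = xy
  orient-adj (suc zero) xy = adj-∸ˡ b xy
  orient-adj (suc (suc r)) xy = orient-adj r xy

  orient-turn : ∀ r → orient (suc r) (orient r b) ≡ 0
  orient-turn zero = n∸n≡0 b
  orient-turn (suc zero) = n∸n≡0 b
  orient-turn (suc (suc r)) = orient-turn r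

  corner-≤ : ∀ r r' → corner r r' ≤ b
  corner-≤ r r' = orient-≤ (r ⊓ r') ≤-refl

  snake-≤ : ∀ {r R x} → r ≤ R → x ≤ b → snake r x ≤ b + R * suc b
  snake-≤ {r} r≤R x≤b = +-mono-≤ (orient-≤ r x≤b) (*-monoˡ-≤ (suc b) r≤R)

  snake-adj : ∀ r → snake r Preserves Adj ⟶ Adj
  snake-adj r xy = adj-+ʳ (r * suc b) (orient-adj r xy)

  snake-next-row : ∀ r → snake (suc r) (orient r b) ≡ suc (snake r (orient r b))
  snake-next-row r = begin
    orient (suc r) (orient r b) + suc r * suc b  ≡⟨ cong (_+ suc r * suc b) (orient-turn r) ⟩
    suc (b + r * suc b)                           ≡⟨ cong (λ x → suc (x + r * suc b)) (orient-involutive r ≤-refl) ⟨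
    suc (orient r (orient r b) + r * suc b)       ∎

  snake-turn : ∀ {r r'} → Adj r r' → Adj (snake r (corner r r')) (snake r' (corner r r'))
  snake-turn {r} rr' with adj-cases rr'
  ... | inj₁ refl = adj-refl _
  ... | inj₂ (inj₁ refl) rewrite m≤n⇒m⊓n≡m (n≤1+n r) =
    subst (Adj _) (sym (snake-next-row r)) (adj-suc _)
  snake-turn {r' = r'} rr' | inj₂ (inj₂ refl) rewrite m≥n⇒m⊓n≡n (n≤1+n r') =
    subst (λ z → Adj z (snake r' (orient r' b))) (sym (snake-next-row r')) (adj-sym (adj-suc _))

  snake-injective : ∀ {r r' x x'} → x ≤ b → x' ≤ b → snake r x ≡ snake r' x' → r ≡ r' × x ≡ x'
  snake-injective {r} {r'} {x} {x'} x≤b x'≤b same = same-row , same-column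
    where
      o< : orient r x < suc b
      o< = s≤s (orient-≤ r x≤b)
      o'< : orient r' x' < suc b
      o'< = s≤s (orient-≤ r' x'≤b)
      same-row : r ≡ r'
      same-row = trans (sym ([m+kn]/n≡k r o<)) (trans (cong (_/ suc b) same) ([m+kn]/n≡k r' o'<))
      same-orient : orient r x ≡ orient r' x'
      same-orient = trans (sym ([m+kn]%n≡m r o<)) (trans (cong (_% suc b) same) ([m+kn]%n≡m r' o'<))
      same-column : x ≡ x'
      same-column = begin
        x                            ≡⟨ orient-involutive r x≤b ⟨
        orient r (orient r x)        ≡⟨ cong (orient r) same-orient ⟩
        orient r (orient r' x')      ≡⟨ cong (λ s → orient s (orient r' x')) same-row ⟩
        orient r' (orient r' x')     ≡⟨ orient-involutive r' x'≤b ⟩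
        x'                           ∎

switch : ℕ → ℕ → ℕ → ℕ → ℕ
switch p r r' q with q ≤? p
... | yes _ = r
... | no _ = r'

module _ {p r r' : ℕ} where
  switch-≤ : ∀ {q} → q ≤ p → switch p r r' q ≡ r
  switch-≤ {q} q≤p with q ≤? p
  ... | yes _ = refl
  ... | no q≰p = contradiction q≤p q≰p

  switch-> : ∀ {q} → p < q → switch p r r' q ≡ r'
  switch-> {q} p<q with q ≤? p
  ... | yes q≤p = contradiction q≤p (<⇒≱ p<q)
  ... | no _ = refl

  switch-cases : ∀ q → switch p r r' q ≡ r ⊎ switch p r r' q ≡ r'
  switch-cases q with q ≤? p
  ... | yes _ = inj₁ refl
  ... | no _ = inj₂ refl

  switch-step : ∀ q → switch p r r' q ≡ switch p r r' (suc q) ⊎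
                      (q ≡ p × switch p r r' q ≡ r × switch p r r' (suc q) ≡ r')
  switch-step q with <-cmp q p
  ... | tri< q<p _ _ = inj₁ (trans (switch-≤ (<⇒≤ q<p)) (sym (switch-≤ q<p)))
  ... | tri≈ _ q≡p _ =
    inj₂ (q≡p , switch-≤ (≤-reflexive q≡p) , switch-> (s≤s (≤-reflexive (sym q≡p))))
  ... | tri> _ _ p<q = inj₁ (trans (switch-> p<q) (sym (switch-> (m<n⇒m<1+n p<q))))

module Construction (a b a' b' : ℕ) where
  open Tent a
  open Glue ℓ
  open Snake b

  a⁺ b⁺ : ℕ
  a⁺ = ℓ + (a' + a') * suc ℓ
  b⁺ = b + (b' + b') * suc b

  α α' : ℕ → ℕ
  α = glue λ _ q → tent q
  α' = glue λ k _ → ⌊ k /2⌋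

  αWalk : Walk a⁺ a
  αWalk = record
    { pos       = α
    ; step      = glue-step (λ _ q → tent q) (λ _ q _ → tent-adj (adj-suc q)) (λ _ → adj-reflexive tent-ℓ)
    ; bounded   = λ {t} _ → tent-≤ (t % suc ℓ)
    ; reaches-0 = 0 , z≤n , refl
    ; reaches-M = M + 0 , +-mono-≤ (<⇒≤ M<ℓ) z≤n ,
                  trans (glue-at (λ _ q → tent q) 0 (<⇒≤ M<ℓ)) (tent-double+1 ≤-refl)
    }

  α'Walk : Walk a⁺ a'
  α'Walk = record
    { pos       = α'
    ; step      = glue-step (λ k _ → ⌊ k /2⌋) (λ _ _ _ → adj-refl _) ⌊/2⌋-step
    ; bounded   = λ t≤a⁺ →
                  ≤-trans (⌊n/2⌋-mono (glue-block-≤ (a' + a') t≤a⁺)) (≤-reflexive (sym (n≡⌊n+n/2⌋ a')))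
    ; reaches-0 = 0 , z≤n , refl
    ; reaches-M = a⁺ , ≤-refl ,
                  trans (glue-at (λ k _ → ⌊ k /2⌋) (a' + a') ≤-refl) (sym (n≡⌊n+n/2⌋ a'))
    }

  module Lift (φ : Epi a b) (φ' : Epi a' b') where
    home-row : ℕ → ℕ
    home-row k = epiℕ φ' ⌊ k /2⌋ + epiℕ φ' ⌊ k /2⌋

    level : ℕ → ℕ
    level k = epiℕ φ' ⌊ k /2⌋ + epiℕ φ' ⌈ k /2⌉

    level-≤ : ∀ k → level k ≤ b' + b'
    level-≤ k = +-mono-≤ (epiℕ-≤ φ' _) (epiℕ-≤ φ' _)

    level-step : ∀ k → Adj (level k) (level (suc k))
    level-step k =
      subst (Adj (level k)) (+-comm (epiℕ φ' (suc ⌊ k /2⌋)) (epiℕ φ' ⌈ k /2⌉))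
        (adj-+ʳ (epiℕ φ' ⌈ k /2⌉) (epiℕ-adj φ' (adj-suc ⌊ k /2⌋)))

    level-pred-step : ∀ k → Adj (level (k ∸ 1)) (level k)
    level-pred-step zero = adj-refl _
    level-pred-step (suc k) = level-step k

    level-near : ∀ k → Adj (level k) (home-row k)
    level-near k = adj-+ˡ (epiℕ φ' ⌊ k /2⌋) (adj-sym (epiℕ-adj φ' (⌊/2⌋-step k)))

    level-pred-near : ∀ k → Adj (level (k ∸ 1)) (home-row k)
    level-pred-near zero = adj-refl _
    level-pred-near (suc k) = adj-+ʳ (epiℕ φ' ⌈ k /2⌉) (epiℕ-adj φ' (⌊/2⌋-step k))

    level-double : ∀ j → level (j + j) ≡ epiℕ φ' j + epiℕ φ' j
    level-double j = cong₂ (λ u v → epiℕ φ' u + epiℕ φ' v) (sym (n≡⌊n+n/2⌋ j)) (sym (n≡⌈n+n/2⌉ j))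

    turning : ∀ k → ∃[ y ] y ≤ a × epiℕ φ y ≡ corner (level (k ∸ 1)) (level k)
    turning k = epiℕ-onto φ (corner-≤ (level (k ∸ 1)) (level k))

    turn : ℕ → ℕ
    turn k = proj₁ (turning k)

    turn-≤ : ∀ k → turn k ≤ a
    turn-≤ k = proj₁ (proj₂ (turning k))

    row : ℕ → ℕ → ℕ
    row k = switch (turn k + turn k) (level (k ∸ 1)) (level k)

    cell : ℕ → ℕ → ℕ
    cell k q = snake (row k q) (epiℕ φ (tent q))

    lift : ℕ → ℕ
    lift = glue cell

    row-≤ : ∀ k q → row k q ≤ b' + b'
    row-≤ k q = [ (λ e → subst (_≤ b' + b') (sym e) (level-≤ (k ∸ 1)))
                , (λ e → subst (_≤ b' + b') (sym e) (level-≤ k)) ]′ (switch-cases q)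

    row-near : ∀ k q → Adj (row k q) (home-row k)
    row-near k q = [ (λ e → subst (λ r → Adj r (home-row k)) (sym e) (level-pred-near k))
                   , (λ e → subst (λ r → Adj r (home-row k)) (sym e) (level-near k)) ]′ (switch-cases q)

    cell-step : ∀ k q → Adj (cell k q) (cell k (suc q))
    cell-step k q = [ same-row , row-switch ]′ (switch-step q)
      where
        corner-k : ℕ
        corner-k = corner (level (k ∸ 1)) (level k)

        same-row : row k q ≡ row k (suc q) → Adj (cell k q) (cell k (suc q))
        same-row e = subst (λ r → Adj (cell k q) (snake r (epiℕ φ (tent (suc q))))) e
                       (snake-adj (row k q) (epiℕ-adj φ (tent-adj (adj-suc q))))

        φ-turn : ∀ {q'} → tent q' ≡ turn k → epiℕ φ (tent q') ≡ corner-k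
        φ-turn tent≡ = trans (cong (epiℕ φ) tent≡) (proj₂ (proj₂ (turning k)))

        row-switch : q ≡ turn k + turn k × row k q ≡ level (k ∸ 1) × row k (suc q) ≡ level k →
                     Adj (cell k q) (cell k (suc q))
        row-switch (q≡turn , before , after) =
          subst₂ Adj (sym at-turn) (sym after-turn) (snake-turn (level-pred-step k))
          where
            at-turn : cell k q ≡ snake (level (k ∸ 1)) corner-k
            at-turn = cong₂ snake before (φ-turn (trans (cong tent q≡turn) (tent-double (turn-≤ k))))
            after-turn : cell k (suc q) ≡ snake (level k) corner-k
            after-turn =
              cong₂ snake after (φ-turn (trans (cong (tent ∘ suc) q≡turn) (tent-double+1 (turn-≤ k))))

    cell-boundary : ∀ k → cell k ℓ ≡ cell (suc k) 0
    cell-boundary k = cong₂ snake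
      (trans (switch-> (<-trans (double<M (turn-≤ k)) M<ℓ))
             (sym (switch-≤ {turn (suc k) + turn (suc k)} {level k} {level (suc k)} z≤n)))
      (cong (epiℕ φ) tent-ℓ)

    lift-reaches-even : ∀ {k x} → k ≤ b' → x ≤ b → Reaches a⁺ lift (snake (k + k) x)
    lift-reaches-even {k} {x} k≤b' x≤b = reach (epiℕ-onto φ' k≤b') (epiℕ-onto φ x≤b)
      where
        reach : ∃[ j ] j ≤ a' × epiℕ φ' j ≡ k → ∃[ y ] y ≤ a × epiℕ φ y ≡ x →
                Reaches a⁺ lift (snake (k + k) x)
        reach (j , j≤a' , φ'j≡k) (y , y≤a , φy≡x) = q + (j + j) * suc ℓ , t≤a⁺ , (begin
          lift (q + (j + j) * suc ℓ)              ≡⟨ glue-at cell (j + j) (m∸n≤m ℓ (y + y)) ⟩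
          snake (row (j + j) q) (epiℕ φ (tent q)) ≡⟨ cong₂ snake (switch-> turn<q)
                                                                  (cong (epiℕ φ) (tent-mirror-double y≤a)) ⟩
          snake (level (j + j)) (epiℕ φ y)        ≡⟨ cong₂ snake (trans (level-double j) (cong₂ _+_ φ'j≡k φ'j≡k))
                                                                  φy≡x ⟩
          snake (k + k) x                         ∎)
          where
            q : ℕ
            q = ℓ ∸ (y + y)
            turn<q : turn (j + j) + turn (j + j) < q
            turn<q = <-trans (double<M (turn-≤ (j + j))) (M<ℓ∸ (<⇒≤ (double<M y≤a)))
            t≤a⁺ : q + (j + j) * suc ℓ ≤ a⁺
            t≤a⁺ = +-mono-≤ (m∸n≤m ℓ (y + y)) (*-monoˡ-≤ (suc ℓ) (+-mono-≤ j≤a' j≤a'))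

    liftWalk : Walk a⁺ b⁺
    liftWalk = record
      { pos       = lift
      ; step      = glue-step cell (λ k q _ → cell-step k q) (λ k → adj-reflexive (cell-boundary k))
      ; bounded   = λ {t} _ → snake-≤ (row-≤ (t / suc ℓ) (t % suc ℓ)) (epiℕ-≤ φ _)
      ; reaches-0 = lift-reaches-even z≤n z≤n
      ; reaches-M = subst (Reaches a⁺ lift)
                      (cong (_+ (b' + b') * suc b) (orient-involutive (b' + b') ≤-refl))
                      (lift-reaches-even ≤-refl (orient-≤ (b' + b') ≤-refl))
      }

  open Lift using (liftWalk; row-near)

  liftEpi : Epi a b → Epi a' b' → Epi a⁺ b⁺
  liftEpi φ φ' = walkEpi (liftWalk φ φ')

  module _ (φ ψ : Epi a b) (φ' ψ' : Epi a' b') where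
    lift-exact : ∀ t₀ t₁ → Lift.lift φ φ' t₀ ≡ Lift.lift ψ ψ' t₁ →
                 epiℕ φ (α t₀) ≡ epiℕ ψ (α t₁) × Adj (epiℕ φ' (α' t₀)) (epiℕ ψ' (α' t₁))
    lift-exact t₀ t₁ same =
      same-column ,
      double-adj⁻¹ (subst (λ r → Adj r (Lift.home-row φ φ' k₀)) same-row (row-near φ φ' k₀ q₀)) (row-near ψ ψ' k₁ q₁)
      where
        k₀ q₀ k₁ q₁ : ℕ
        k₀ = t₀ / suc ℓ
        q₀ = t₀ % suc ℓ
        k₁ = t₁ / suc ℓ
        q₁ = t₁ % suc ℓ
        same-cell : Lift.row φ φ' k₀ q₀ ≡ Lift.row ψ ψ' k₁ q₁ ×
                    epiℕ φ (α t₀) ≡ epiℕ ψ (α t₁)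
        same-cell = snake-injective (epiℕ-≤ φ (α t₀)) (epiℕ-≤ ψ (α t₁)) same
        same-row = proj₁ same-cell
        same-column = proj₂ same-cell

    lift-exact-at : ∀ x₀ x₁ → fun (liftEpi φ φ') x₀ ≡ fun (liftEpi ψ ψ') x₁ →
                    epiℕ φ (α (toℕ x₀)) ≡ epiℕ ψ (α (toℕ x₁)) ×
                    Adj (epiℕ φ' (α' (toℕ x₀))) (epiℕ ψ' (α' (toℕ x₁)))
    lift-exact-at x₀ x₁ same =
      lift-exact (toℕ x₀) (toℕ x₁) (walkFun-agree (liftWalk φ φ') (liftWalk ψ ψ') {x₀} {x₁} same)

    liftEpi-isEpiFrom : IsEpiFrom (walkEpi αWalk) (liftEpi φ φ') (liftEpi ψ ψ') φ ψ
    liftEpi-isEpiFrom x₀ x₁ same = toℕ-injective (begin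
      toℕ (fun φ (walkFun αWalk x₀))  ≡⟨ toℕ-fun-walkFun φ αWalk x₀ ⟩
      epiℕ φ (α (toℕ x₀))             ≡⟨ proj₁ (lift-exact-at x₀ x₁ same) ⟩
      epiℕ ψ (α (toℕ x₁))             ≡⟨ toℕ-fun-walkFun ψ αWalk x₁ ⟨
      toℕ (fun ψ (walkFun αWalk x₁))  ∎)

    liftEpi-isApproxEpiFrom : IsApproxEpiFrom (walkEpi α'Walk) (liftEpi φ φ') (liftEpi ψ ψ') φ' ψ'
    liftEpi-isApproxEpiFrom x₀ x₁ same =
      subst₂ Adj (sym (toℕ-fun-walkFun φ' α'Walk x₀)) (sym (toℕ-fun-walkFun ψ' α'Walk x₁))
        (proj₂ (lift-exact-at x₀ x₁ same))

corollary4p3 : (n : ℕ) → (a b a' b' : ℕ) →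
    (f g : Fin (suc n) → Epi a b) → (f' g' : Fin (suc n) → Epi a' b') →
    Σ ℕ λ a⁺ → Σ ℕ λ b⁺ →
    Σ (Fin (suc n) → Epi a⁺ b⁺) λ f⁺ → Σ (Fin (suc n) → Epi a⁺ b⁺) λ g⁺ →
    Σ (Epi a⁺ a) λ α → Σ (Epi a⁺ a') λ α' →
    ((i : Fin (suc n)) →
      IsEpiFrom α (f⁺ i) (g⁺ i) (f i) (g i) ×
      IsApproxEpiFrom α' (f⁺ i) (g⁺ i) (f' i) (g' i))
corollary4p3 n a b a' b' f g f' g' =
  a⁺ , b⁺ , (λ i → liftEpi (f i) (f' i)) , (λ i → liftEpi (g i) (g' i)) ,
  walkEpi αWalk , walkEpi α'Walk ,
  λ i → liftEpi-isEpiFrom (f i) (g i) (f' i) (g' i) , liftEpi-isApproxEpiFrom (f i) (g i) (f' i) (g' i)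
  where open Construction a b a' b'
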